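{- For each integer $k\ge1$, let $L_k(x)=\sum_{n\ge1}\ell_k(n)x^n$, where $\ell_k(n)$ is the total number of vertices having exactly $k$ vertices in their subtree, summed over all ordered trees with $n$ vertices. Let $R_k(x)$ be the generating function (by number of vertices) of ordered trees whose root has exactly $k$ vertices in its subtree. Then, as formal power series, $$L_k(x)=R_k(x)\cdot\frac12\left(1+\frac{1}{\sqrt{1-4x}}\right).$$
   Context: An ordered tree is a rooted planar tree with no restriction on the number of children of a vertex; its size is its number of vertices. The subtree of a vertex $v$ consists of $v$ together with all of its descendants. The square root denotes the formal power series with constant term $1$. -}

module Defs where

open import Data.Nat as ℕ using (ℕ; zero; suc; _∸_; _≡ᵇ_)
open import Data.Bool using (if_then_else_)
open import Data.List using (List; []; _∷_; [_]; map; concatMap; upTo; length; filter)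
open import Data.Nat.ListAction using (sum)
open import Data.Integer using (+_)
open import Data.Rational as ℚ using (ℚ; 0ℚ; 1ℚ; ½)
open import Relation.Binary.PropositionalEquality using (_≡_)

data Tree : Set where
  node : List Tree → Tree

mutual
  size : Tree → ℕ
  size (node ts) = suc (sizeF ts)

  sizeF : List Tree → ℕ
  sizeF []       = 0
  sizeF (t ∷ ts) = size t ℕ.+ sizeF ts

mutual
  countSub : ℕ → Tree → ℕ
  countSub k (node ts) = (if size (node ts) ≡ᵇ k then 1 else 0) ℕ.+ countSubF k ts

  countSubF : ℕ → List Tree → ℕ
  countSubF k []       = 0
  countSubF k (t ∷ ts) = countSub k t ℕ.+ countSubF k ts

-- Enumeration of all ordered trees with a given number of vertices.
-- forestsF fuel m : all ordered forests (lists of trees) with m vertices in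
-- total, provided fuel ≥ m.  The first tree has j+1 vertices (0 ≤ j ≤ m−1
-- ranges over upTo m shifted), its children form a forest of size j, the rest
-- a forest of size m−1−j.

forestsF : ℕ → ℕ → List (List Tree)
forestsF _        zero    = [ [] ]
forestsF zero     (suc m) = []
forestsF (suc f) (suc m) =
  concatMap (λ j → concatMap (λ cs → map (λ rest → node cs ∷ rest)
                                          (forestsF f (m ∸ j)))
                             (forestsF f j))
            (upTo (suc m))

forests : ℕ → List (List Tree)
forests m = forestsF m m

trees : ℕ → List Tree
trees zero    = []
trees (suc m) = map node (forests m)

ell : ℕ → ℕ → ℕ
ell k n = sum (map (countSub k) (trees n))

rootCount : ℕ → ℕ → ℕ
rootCount k n = length (filter (λ t → size t ℕ.≟ k) (trees n))

PS : Set
PS = ℕ → ℚ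

fromℕ : ℕ → ℚ
fromℕ n = + n ℚ./ 1

const : ℚ → PS
const c zero    = c
const c (suc _) = 0ℚ

_⊕_ : PS → PS → PS
(f ⊕ g) n = f n ℚ.+ g n

_·_ : ℚ → PS → PS
(c · f) n = c ℚ.* f n

_⊛_ : PS → PS → PS
(f ⊛ g) n = Data.List.foldr ℚ._+_ 0ℚ (map (λ i → f i ℚ.* g (n ∸ i)) (upTo (suc n)))

oneMinus4x : PS
oneMinus4x zero          = 1ℚ
oneMinus4x (suc zero)    = ℚ.- (+ 4 ℚ./ 1)
oneMinus4x (suc (suc _)) = 0ℚ

_≋_ : PS → PS → Set
f ≋ g = ∀ n → f n ≡ g n

L : ℕ → PS
L k n = fromℕ (ell k n)

R : ℕ → PS
R k n = fromℕ (rootCount k n)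

{-# OPTIONS --safe #-}

-- A nonempty ordered forest is its first tree, i.e. a root above a forest, followed by the
-- forest of the remaining trees.  So the generating function N of forests by number of
-- vertices satisfies N = 1 + xN², whence (1 − 2xN)² = 1 − 4x; as a square root with constant
-- term 1 is unique, Q = 1 − 2xN and P = 1/(1 − 2xN).
-- Let A count, over all forests, the vertices whose subtree has k vertices.  A tree with m + 1
-- vertices is a root above a forest with m vertices, so L = R + xA; splitting off the first
-- tree gives A = LN + xNA = RN + 2xAN, i.e. A(1 − 2xN) = RN and A = RNP.  Finally
-- P = 1 + 2xNP, so L = R(1 + xNP) = R · ½(1 + P).
module Submission where

open import Defs
open import Data.Nat using (ℕ; _≤_)
open import Data.Rational using (1ℚ; ½)
open import Relation.Binary.PropositionalEquality using (_≡_; refl; sym; trans)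

module FormalPowerSeries where

  open import Data.Nat as ℕ using (ℕ; zero; suc; _∸_; _<_; z≤n; s≤s; z<s)
  import Data.Nat.Properties as ℕ
  open import Data.Nat.Induction using (<-rec)
  open import Data.List using (foldr; applyUpTo)
  import Data.List.Properties as List
  open import Data.Rational using (ℚ; 0ℚ; 1ℚ; ½; _+_; _*_; -_; 1/_; NonZero; ≢-nonZero)
  import Data.Rational.Properties as ℚ
  open import Data.Rational.Solver using (module +-*-Solver)
  open import Function using (_∘_)
  open import Level using (0ℓ)
  open import Relation.Binary.Bundles using (Setoid)
  open import Relation.Binary.PropositionalEquality
  import Relation.Binary.Reasoning.Setoid

  open +-*-Solver

  ∑ : ℕ → (ℕ → ℚ) → ℚ
  ∑ n f = foldr _+_ 0ℚ (applyUpTo f n)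

  ∑-last : ∀ n h → ∑ (suc n) h ≡ ∑ n h + h n
  ∑-last zero    h = trans (ℚ.+-identityʳ (h 0)) (sym (ℚ.+-identityˡ (h 0)))
  ∑-last (suc n) h = trans (cong (h 0 +_) (∑-last n (h ∘ suc))) (sym (ℚ.+-assoc (h 0) _ _))

  ∑-cong< : ∀ n {h h′} → (∀ i → i < n → h i ≡ h′ i) → ∑ n h ≡ ∑ n h′
  ∑-cong< zero    eq = refl
  ∑-cong< (suc n) eq = cong₂ _+_ (eq 0 (s≤s z≤n)) (∑-cong< n (λ i i<n → eq (suc i) (s≤s i<n)))

  ∑-cong : ∀ n {h h′} → (∀ i → h i ≡ h′ i) → ∑ n h ≡ ∑ n h′
  ∑-cong n eq = ∑-cong< n (λ i _ → eq i)

  ∑-zero : ∀ n → ∑ n (λ _ → 0ℚ) ≡ 0ℚ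
  ∑-zero zero    = refl
  ∑-zero (suc n) = trans (ℚ.+-identityˡ _) (∑-zero n)

  ∑-+ : ∀ n f g → ∑ n (λ i → f i + g i) ≡ ∑ n f + ∑ n g
  ∑-+ zero    f g = refl
  ∑-+ (suc n) f g = trans (cong (f 0 + g 0 +_) (∑-+ n (f ∘ suc) (g ∘ suc)))
    (solve 4 (λ a b c d → (a :+ b) :+ (c :+ d) := (a :+ c) :+ (b :+ d)) refl
      (f 0) (g 0) (∑ n (f ∘ suc)) (∑ n (g ∘ suc)))

  ∑-*ˡ : ∀ n c f → c * ∑ n f ≡ ∑ n (λ i → c * f i)
  ∑-*ˡ zero    c f = ℚ.*-zeroʳ c
  ∑-*ˡ (suc n) c f = trans (ℚ.*-distribˡ-+ c (f 0) _) (cong (c * f 0 +_) (∑-*ˡ n c (f ∘ suc)))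

  ∑-*ʳ : ∀ n c f → ∑ n f * c ≡ ∑ n (λ i → f i * c)
  ∑-*ʳ n c f = trans (ℚ.*-comm _ c) (trans (∑-*ˡ n c f) (∑-cong n (λ i → ℚ.*-comm c (f i))))

  ∑-reverse : ∀ n h → ∑ n h ≡ ∑ n (λ i → h (n ∸ suc i))
  ∑-reverse zero    h = refl
  ∑-reverse (suc n) h = trans (∑-last n h) (trans (cong (_+ h n) (∑-reverse n h)) (ℚ.+-comm _ (h n)))

  ∑-triangle : ∀ n (F : ℕ → ℕ → ℚ) →
    ∑ (suc n) (λ i → ∑ (suc i) (F i)) ≡ ∑ (suc n) (λ j → ∑ (suc (n ∸ j)) (λ l → F (j ℕ.+ l) j))
  ∑-triangle zero    F = refl
  ∑-triangle (suc n) F = begin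
      ∑ (suc (suc n)) (λ i → ∑ (suc i) (F i))
    ≡⟨ ∑-last (suc n) (λ i → ∑ (suc i) (F i)) ⟩
      ∑ (suc n) (λ i → ∑ (suc i) (F i)) + ∑ (suc (suc n)) (F (suc n))
    ≡⟨ cong₂ _+_ (∑-triangle n F) (∑-last (suc n) (F (suc n))) ⟩
      ∑ (suc n) G + (∑ (suc n) (F (suc n)) + F (suc n) (suc n))
    ≡⟨ ℚ.+-assoc (∑ (suc n) G) _ _ ⟨
      (∑ (suc n) G + ∑ (suc n) (F (suc n))) + F (suc n) (suc n)
    ≡⟨ cong₂ _+_ (sym (∑-+ (suc n) G (F (suc n)))) diagonal ⟩
      ∑ (suc n) (λ j → G j + F (suc n) j) + H (suc n)
    ≡⟨ cong (_+ H (suc n)) (∑-cong< (suc n) extend) ⟩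
      ∑ (suc n) H + H (suc n)
    ≡⟨ ∑-last (suc n) H ⟨
      ∑ (suc (suc n)) H
    ∎
    where
    open ≡-Reasoning
    G H : ℕ → ℚ
    G j = ∑ (suc (n ∸ j)) (λ l → F (j ℕ.+ l) j)
    H j = ∑ (suc (suc n ∸ j)) (λ l → F (j ℕ.+ l) j)
    diagonal : F (suc n) (suc n) ≡ H (suc n)
    diagonal rewrite ℕ.n∸n≡0 n | ℕ.+-identityʳ n = sym (ℚ.+-identityʳ _)
    extend : ∀ j → j < suc n → G j + F (suc n) j ≡ H j
    extend j (s≤s j≤n) = begin
        G j + F (suc n) j
      ≡⟨ cong (λ m → G j + F m j) (trans (ℕ.+-suc j (n ∸ j)) (cong suc (ℕ.m+[n∸m]≡n j≤n))) ⟨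
        G j + F (j ℕ.+ suc (n ∸ j)) j
      ≡⟨ ∑-last (suc (n ∸ j)) (λ l → F (j ℕ.+ l) j) ⟨
        ∑ (suc (suc (n ∸ j))) (λ l → F (j ℕ.+ l) j)
      ≡⟨ cong (λ m → ∑ (suc m) (λ l → F (j ℕ.+ l) j)) (ℕ.+-∸-assoc 1 j≤n) ⟨
        H j
      ∎

  shift : PS → PS
  shift f zero    = 0ℚ
  shift f (suc n) = f n

  0# : PS
  0# _ = 0ℚ

  2ℚ : ℚ
  2ℚ = 1ℚ + 1ℚ

  ≋-setoid : Setoid 0ℓ 0ℓ
  ≋-setoid = record
    { Carrier       = PS
    ; _≈_           = _≋_
    ; isEquivalence = record
      { refl  = λ _ → refl
      ; sym   = λ f≋g n → sym (f≋g n)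
      ; trans = λ f≋g g≋h n → trans (f≋g n) (g≋h n)
      }
    }

  module ≋-Reasoning = Relation.Binary.Reasoning.Setoid ≋-setoid

  ⊕-cong : ∀ {f f′ g g′} → f ≋ f′ → g ≋ g′ → (f ⊕ g) ≋ (f′ ⊕ g′)
  ⊕-cong f≋f′ g≋g′ n = cong₂ _+_ (f≋f′ n) (g≋g′ n)

  ⊕-congˡ : ∀ f {g g′} → g ≋ g′ → (f ⊕ g) ≋ (f ⊕ g′)
  ⊕-congˡ f g≋g′ n = cong (f n +_) (g≋g′ n)

  ⊕-congʳ : ∀ g {f f′} → f ≋ f′ → (f ⊕ g) ≋ (f′ ⊕ g)
  ⊕-congʳ g f≋f′ n = cong (_+ g n) (f≋f′ n)

  shift-cong : ∀ {f g} → f ≋ g → shift f ≋ shift g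
  shift-cong f≋g zero    = refl
  shift-cong f≋g (suc n) = f≋g n

  ⊛-as-∑ : ∀ f g n → (f ⊛ g) n ≡ ∑ (suc n) (λ i → f i * g (n ∸ i))
  ⊛-as-∑ f g n = cong (foldr _+_ 0ℚ) (List.map-upTo (λ i → f i * g (n ∸ i)) (suc n))

  ⊛-cong : ∀ {f f′ g g′} → f ≋ f′ → g ≋ g′ → (f ⊛ g) ≋ (f′ ⊛ g′)
  ⊛-cong {f} {f′} {g} {g′} f≋f′ g≋g′ n = begin
    (f ⊛ g) n                                   ≡⟨ ⊛-as-∑ f g n ⟩
    ∑ (suc n) (λ i → f i * g (n ∸ i))           ≡⟨ ∑-cong (suc n) (λ i → cong₂ _*_ (f≋f′ i) (g≋g′ (n ∸ i))) ⟩
    ∑ (suc n) (λ i → f′ i * g′ (n ∸ i))         ≡⟨ ⊛-as-∑ f′ g′ n ⟨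
    (f′ ⊛ g′) n                                 ∎
    where open ≡-Reasoning

  ⊛-congˡ : ∀ f {g g′} → g ≋ g′ → (f ⊛ g) ≋ (f ⊛ g′)
  ⊛-congˡ f = ⊛-cong {f} {f} (λ _ → refl)

  ⊛-congʳ : ∀ g {f f′} → f ≋ f′ → (f ⊛ g) ≋ (f′ ⊛ g)
  ⊛-congʳ g f≋f′ = ⊛-cong f≋f′ (λ _ → refl)

  ⊛-comm : ∀ f g → (f ⊛ g) ≋ (g ⊛ f)
  ⊛-comm f g n = begin
    (f ⊛ g) n                                   ≡⟨ ⊛-as-∑ f g n ⟩
    ∑ (suc n) (λ i → f i * g (n ∸ i))           ≡⟨ ∑-reverse (suc n) (λ i → f i * g (n ∸ i)) ⟩
    ∑ (suc n) (λ i → f (n ∸ i) * g (n ∸ (n ∸ i))) ≡⟨ ∑-cong< (suc n) swap ⟩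
    ∑ (suc n) (λ i → g i * f (n ∸ i))           ≡⟨ ⊛-as-∑ g f n ⟨
    (g ⊛ f) n                                   ∎
    where
    open ≡-Reasoning
    swap : ∀ i → i < suc n → f (n ∸ i) * g (n ∸ (n ∸ i)) ≡ g i * f (n ∸ i)
    swap i (s≤s i≤n) rewrite ℕ.m∸[m∸n]≡n i≤n = ℚ.*-comm (f (n ∸ i)) (g i)

  ⊛-assoc : ∀ f g h → ((f ⊛ g) ⊛ h) ≋ (f ⊛ (g ⊛ h))
  ⊛-assoc f g h n = begin
    ((f ⊛ g) ⊛ h) n
      ≡⟨ ⊛-as-∑ (f ⊛ g) h n ⟩
    ∑ (suc n) (λ i → (f ⊛ g) i * h (n ∸ i))
      ≡⟨ ∑-cong (suc n) (λ i → trans (cong (_* h (n ∸ i)) (⊛-as-∑ f g i))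
                                     (∑-*ʳ (suc i) (h (n ∸ i)) (λ j → f j * g (i ∸ j)))) ⟩
    ∑ (suc n) (λ i → ∑ (suc i) (F i))
      ≡⟨ ∑-triangle n F ⟩
    ∑ (suc n) (λ j → ∑ (suc (n ∸ j)) (λ l → F (j ℕ.+ l) j))
      ≡⟨ ∑-cong (suc n) (λ j → trans (∑-cong (suc (n ∸ j)) (reassociate j))
                                     (sym (∑-*ˡ (suc (n ∸ j)) (f j) (λ l → g l * h (n ∸ j ∸ l))))) ⟩
    ∑ (suc n) (λ j → f j * ∑ (suc (n ∸ j)) (λ l → g l * h (n ∸ j ∸ l)))
      ≡⟨ ∑-cong (suc n) (λ j → cong (f j *_) (⊛-as-∑ g h (n ∸ j))) ⟨
    ∑ (suc n) (λ j → f j * (g ⊛ h) (n ∸ j))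
      ≡⟨ ⊛-as-∑ f (g ⊛ h) n ⟨
    (f ⊛ (g ⊛ h)) n
      ∎
    where
    open ≡-Reasoning
    F : ℕ → ℕ → ℚ
    F i j = f j * g (i ∸ j) * h (n ∸ i)
    reassociate : ∀ j l → F (j ℕ.+ l) j ≡ f j * (g l * h (n ∸ j ∸ l))
    reassociate j l rewrite ℕ.m+n∸m≡n j l | ℕ.∸-+-assoc n j l = ℚ.*-assoc (f j) (g l) _

  ⊛-distribʳ : ∀ h f g → ((f ⊕ g) ⊛ h) ≋ ((f ⊛ h) ⊕ (g ⊛ h))
  ⊛-distribʳ h f g n = begin
    ((f ⊕ g) ⊛ h) n
      ≡⟨ ⊛-as-∑ (f ⊕ g) h n ⟩
    ∑ (suc n) (λ i → (f i + g i) * h (n ∸ i))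
      ≡⟨ ∑-cong (suc n) (λ i → ℚ.*-distribʳ-+ (h (n ∸ i)) (f i) (g i)) ⟩
    ∑ (suc n) (λ i → f i * h (n ∸ i) + g i * h (n ∸ i))
      ≡⟨ ∑-+ (suc n) (λ i → f i * h (n ∸ i)) (λ i → g i * h (n ∸ i)) ⟩
    ∑ (suc n) (λ i → f i * h (n ∸ i)) + ∑ (suc n) (λ i → g i * h (n ∸ i))
      ≡⟨ cong₂ _+_ (⊛-as-∑ f h n) (⊛-as-∑ g h n) ⟨
    ((f ⊛ h) ⊕ (g ⊛ h)) n
      ∎
    where open ≡-Reasoning

  ⊛-distribˡ : ∀ h f g → (h ⊛ (f ⊕ g)) ≋ ((h ⊛ f) ⊕ (h ⊛ g))
  ⊛-distribˡ h f g n =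
    trans (⊛-comm h (f ⊕ g) n) (trans (⊛-distribʳ h f g n) (cong₂ _+_ (⊛-comm f h n) (⊛-comm g h n)))

  ·-⊛ : ∀ c f g → ((c · f) ⊛ g) ≋ (c · (f ⊛ g))
  ·-⊛ c f g n = begin
    ((c · f) ⊛ g) n                             ≡⟨ ⊛-as-∑ (c · f) g n ⟩
    ∑ (suc n) (λ i → c * f i * g (n ∸ i))       ≡⟨ ∑-cong (suc n) (λ i → ℚ.*-assoc c (f i) (g (n ∸ i))) ⟩
    ∑ (suc n) (λ i → c * (f i * g (n ∸ i)))     ≡⟨ ∑-*ˡ (suc n) c (λ i → f i * g (n ∸ i)) ⟨
    c * ∑ (suc n) (λ i → f i * g (n ∸ i))       ≡⟨ cong (c *_) (⊛-as-∑ f g n) ⟨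
    c * (f ⊛ g) n                               ∎
    where open ≡-Reasoning

  ⊛-· : ∀ c f g → (f ⊛ (c · g)) ≋ (c · (f ⊛ g))
  ⊛-· c f g n = trans (⊛-comm f (c · g) n) (trans (·-⊛ c g f n) (cong (c *_) (⊛-comm g f n)))

  ⊛-identityˡ : ∀ g → (const 1ℚ ⊛ g) ≋ g
  ⊛-identityˡ g n = begin
    (const 1ℚ ⊛ g) n                                  ≡⟨ ⊛-as-∑ (const 1ℚ) g n ⟩
    1ℚ * g n + ∑ n (λ i → 0ℚ * g (n ∸ suc i))         ≡⟨ cong₂ _+_ (ℚ.*-identityˡ (g n)) higher ⟩
    g n + 0ℚ                                          ≡⟨ ℚ.+-identityʳ (g n) ⟩
    g n                                               ∎
    where
    open ≡-Reasoning
    higher : ∑ n (λ i → 0ℚ * g (n ∸ suc i)) ≡ 0ℚ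
    higher = trans (∑-cong n (λ i → ℚ.*-zeroˡ (g (n ∸ suc i)))) (∑-zero n)

  ⊛-identityʳ : ∀ g → (g ⊛ const 1ℚ) ≋ g
  ⊛-identityʳ g n = trans (⊛-comm g (const 1ℚ) n) (⊛-identityˡ g n)

  shift-⊛ : ∀ f g → (shift f ⊛ g) ≋ shift (f ⊛ g)
  shift-⊛ f g zero    = trans (ℚ.+-identityʳ (0ℚ * g 0)) (ℚ.*-zeroˡ (g 0))
  shift-⊛ f g (suc n) = begin
    (shift f ⊛ g) (suc n)                                   ≡⟨ ⊛-as-∑ (shift f) g (suc n) ⟩
    0ℚ * g (suc n) + ∑ (suc n) (λ i → f i * g (n ∸ i))      ≡⟨ cong (_+ ∑ (suc n) (λ i → f i * g (n ∸ i))) (ℚ.*-zeroˡ (g (suc n))) ⟩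
    0ℚ + ∑ (suc n) (λ i → f i * g (n ∸ i))                  ≡⟨ ℚ.+-identityˡ _ ⟩
    ∑ (suc n) (λ i → f i * g (n ∸ i))                       ≡⟨ ⊛-as-∑ f g n ⟨
    (f ⊛ g) n                                               ∎
    where open ≡-Reasoning

  ⊛-shift : ∀ f g → (f ⊛ shift g) ≋ shift (f ⊛ g)
  ⊛-shift f g n = trans (⊛-comm f (shift g) n) (trans (shift-⊛ g f n) (shift-cong (⊛-comm g f) n))

  ⊛≋0⇒≋0 : ∀ S D → S 0 ≢ 0ℚ → (S ⊛ D) ≋ 0# → D ≋ 0#
  ⊛≋0⇒≋0 S D S₀≢0 S⊛D≋0 = <-rec (λ k → D k ≡ 0ℚ) vanishes
    where
    instance
      S₀-nonZero : NonZero (S 0)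
      S₀-nonZero = ≢-nonZero S₀≢0
    vanishes : ∀ k → (∀ {j} → j < k → D j ≡ 0ℚ) → D k ≡ 0ℚ
    vanishes k lower≡0 = begin
      D k                    ≡⟨ ℚ.*-identityˡ (D k) ⟨
      1ℚ * D k               ≡⟨ cong (_* D k) (ℚ.*-inverseˡ (S 0)) ⟨
      1/ S 0 * S 0 * D k     ≡⟨ ℚ.*-assoc (1/ S 0) (S 0) (D k) ⟩
      1/ S 0 * (S 0 * D k)   ≡⟨ cong (1/ S 0 *_) leading≡0 ⟩
      1/ S 0 * 0ℚ            ≡⟨ ℚ.*-zeroʳ (1/ S 0) ⟩
      0ℚ                     ∎
      where
      open ≡-Reasoning
      rest : ℚ
      rest = ∑ k (λ i → S (suc i) * D (k ∸ suc i))
      rest≡0 : rest ≡ 0ℚ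
      rest≡0 = trans (∑-cong< k (λ i i<k → trans (cong (S (suc i) *_) (lower≡0 (ℕ.∸-monoʳ-< z<s i<k)))
                                                 (ℚ.*-zeroʳ (S (suc i)))))
                     (∑-zero k)
      leading≡0 : S 0 * D k ≡ 0ℚ
      leading≡0 = begin
        S 0 * D k          ≡⟨ ℚ.+-identityʳ (S 0 * D k) ⟨
        S 0 * D k + 0ℚ     ≡⟨ cong (S 0 * D k +_) rest≡0 ⟨
        S 0 * D k + rest   ≡⟨ ⊛-as-∑ S D k ⟨
        (S ⊛ D) k          ≡⟨ S⊛D≋0 k ⟩
        0ℚ                 ∎

  square-root-unique : ∀ Q Q′ → Q 0 ≡ 1ℚ → Q′ 0 ≡ 1ℚ → (Q ⊛ Q) ≋ (Q′ ⊛ Q′) → Q ≋ Q′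
  square-root-unique Q Q′ Q₀≡1 Q′₀≡1 Q²≋Q′² k = begin
    Q k                            ≡⟨ solve 2 (λ x y → x := (x :+ con -1ℚ :* y) :+ y) refl (Q k) (Q′ k) ⟩
    Q k + -1ℚ * Q′ k + Q′ k        ≡⟨ cong (_+ Q′ k) (difference≋0 k) ⟩
    0ℚ + Q′ k                      ≡⟨ ℚ.+-identityˡ (Q′ k) ⟩
    Q′ k                           ∎
    where
    open ≡-Reasoning
    -1ℚ : ℚ
    -1ℚ = - 1ℚ
    difference : PS
    difference = Q ⊕ (-1ℚ · Q′)
    sum₀≢0 : (Q ⊕ Q′) 0 ≢ 0ℚ
    sum₀≢0 rewrite Q₀≡1 | Q′₀≡1 = λ ()
    product≋0 : ((Q ⊕ Q′) ⊛ difference) ≋ 0#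
    product≋0 n = begin
      ((Q ⊕ Q′) ⊛ difference) n
        ≡⟨ ⊛-distribʳ difference Q Q′ n ⟩
      (Q ⊛ difference) n + (Q′ ⊛ difference) n
        ≡⟨ cong₂ _+_ (⊛-distribˡ Q Q (-1ℚ · Q′) n) (⊛-distribˡ Q′ Q (-1ℚ · Q′) n) ⟩
      ((Q ⊛ Q) n + (Q ⊛ (-1ℚ · Q′)) n) + ((Q′ ⊛ Q) n + (Q′ ⊛ (-1ℚ · Q′)) n)
        ≡⟨ cong₂ _+_ (cong₂ _+_ (Q²≋Q′² n) (⊛-· -1ℚ Q Q′ n))
                     (cong₂ _+_ (⊛-comm Q′ Q n) (⊛-· -1ℚ Q′ Q′ n)) ⟩
      ((Q′ ⊛ Q′) n + -1ℚ * (Q ⊛ Q′) n) + ((Q ⊛ Q′) n + -1ℚ * (Q′ ⊛ Q′) n)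
        ≡⟨ solve 2 (λ a b → (a :+ con -1ℚ :* b) :+ (b :+ con -1ℚ :* a) := con 0ℚ) refl
             ((Q′ ⊛ Q′) n) ((Q ⊛ Q′) n) ⟩
      0ℚ
        ∎
    difference≋0 : difference ≋ 0#
    difference≋0 = ⊛≋0⇒≋0 (Q ⊕ Q′) difference sum₀≢0 product≋0

  -2ℚ : ℚ
  -2ℚ = - 2ℚ

  shift-· : ∀ c f → shift (c · f) ≋ (c · shift f)
  shift-· c f zero    = sym (ℚ.*-zeroʳ c)
  shift-· c f (suc n) = refl

  ⊛-1+shift : ∀ f g → (f ⊛ (const 1ℚ ⊕ shift g)) ≋ (f ⊕ shift (f ⊛ g))
  ⊛-1+shift f g n = begin
    (f ⊛ (const 1ℚ ⊕ shift g)) n              ≡⟨ ⊛-distribˡ f (const 1ℚ) (shift g) n ⟩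
    (f ⊛ const 1ℚ) n + (f ⊛ shift g) n        ≡⟨ cong₂ _+_ (⊛-identityʳ f n) (⊛-shift f g n) ⟩
    f n + shift (f ⊛ g) n                     ∎
    where open ≡-Reasoning

  oneMinus2xTimes : PS → PS
  oneMinus2xTimes N = const 1ℚ ⊕ shift (-2ℚ · N)

  ⊛-oneMinus2xTimes : ∀ f N n → (f ⊛ oneMinus2xTimes N) n ≡ f n + -2ℚ * shift (f ⊛ N) n
  ⊛-oneMinus2xTimes f N n = begin
    (f ⊛ oneMinus2xTimes N) n           ≡⟨ ⊛-1+shift f (-2ℚ · N) n ⟩
    f n + shift (f ⊛ (-2ℚ · N)) n       ≡⟨ cong (f n +_) (shift-cong (⊛-· -2ℚ f N) n) ⟩
    f n + shift (-2ℚ · (f ⊛ N)) n       ≡⟨ cong (f n +_) (shift-· -2ℚ (f ⊛ N) n) ⟩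
    f n + -2ℚ * shift (f ⊛ N) n         ∎
    where open ≡-Reasoning

  oneMinus2xTimes-square : ∀ N → N ≋ (const 1ℚ ⊕ shift (N ⊛ N)) →
    (oneMinus2xTimes N ⊛ oneMinus2xTimes N) ≋ oneMinus4x
  oneMinus2xTimes-square N N≋1+xN² n = begin
    (Q̂ ⊛ Q̂) n                                  ≡⟨ ⊛-oneMinus2xTimes Q̂ N n ⟩
    Q̂ n + -2ℚ * shift (Q̂ ⊛ N) n                ≡⟨ cong (λ x → Q̂ n + -2ℚ * x) (shift-cong (⊛-comm Q̂ N) n) ⟩
    Q̂ n + -2ℚ * shift (N ⊛ Q̂) n                ≡⟨ coefficient n ⟩
    oneMinus4x n                               ∎
    where
    open ≡-Reasoning
    Q̂ : PS
    Q̂ = oneMinus2xTimes N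
    coefficient : ∀ n → Q̂ n + -2ℚ * shift (N ⊛ Q̂) n ≡ oneMinus4x n
    coefficient zero    = refl
    coefficient (suc n) = begin
      Q̂ (suc n) + -2ℚ * (N ⊛ Q̂) n
        ≡⟨ cong (λ x → Q̂ (suc n) + -2ℚ * x) (⊛-oneMinus2xTimes N N n) ⟩
      (0ℚ + -2ℚ * N n) + -2ℚ * (N n + -2ℚ * s)
        ≡⟨ cong (λ x → (0ℚ + -2ℚ * x) + -2ℚ * (x + -2ℚ * s)) (N≋1+xN² n) ⟩
      (0ℚ + -2ℚ * (const 1ℚ n + s)) + -2ℚ * ((const 1ℚ n + s) + -2ℚ * s)
        ≡⟨ cancellation n ⟩
      oneMinus4x (suc n)
        ∎
      where
      s : ℚ
      s = shift (N ⊛ N) n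
      cancellation : ∀ n → (0ℚ + -2ℚ * (const 1ℚ n + s)) + -2ℚ * ((const 1ℚ n + s) + -2ℚ * s) ≡ oneMinus4x (suc n)
      cancellation zero    = solve 1 (λ s → (con 0ℚ :+ con -2ℚ :* (con 1ℚ :+ s)) :+ con -2ℚ :* ((con 1ℚ :+ s) :+ con -2ℚ :* s)
                                            := con (oneMinus4x 1)) refl s
      cancellation (suc n) = solve 1 (λ s → (con 0ℚ :+ con -2ℚ :* (con 0ℚ :+ s)) :+ con -2ℚ :* ((con 0ℚ :+ s) :+ con -2ℚ :* s)
                                            := con 0ℚ) refl s

  half-one-plus-inverse : ∀ N P → (P ⊛ oneMinus2xTimes N) ≋ const 1ℚ →
    (½ · (const 1ℚ ⊕ P)) ≋ (const 1ℚ ⊕ shift (N ⊛ P))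
  half-one-plus-inverse N P P⊛Q̂≋1 n = begin
    ½ * (const 1ℚ n + P n)                          ≡⟨ cong (λ x → ½ * (const 1ℚ n + x)) P≋1+2xPN ⟩
    ½ * (const 1ℚ n + (const 1ℚ n + 2ℚ * s))        ≡⟨ halve n ⟩
    const 1ℚ n + s                                  ≡⟨ cong (const 1ℚ n +_) (shift-cong (⊛-comm P N) n) ⟩
    const 1ℚ n + shift (N ⊛ P) n                    ∎
    where
    open ≡-Reasoning
    s : ℚ
    s = shift (P ⊛ N) n
    P≋1+2xPN : P n ≡ const 1ℚ n + 2ℚ * s
    P≋1+2xPN = begin
      P n                                ≡⟨ solve 2 (λ p s → p := (p :+ con -2ℚ :* s) :+ con 2ℚ :* s) refl (P n) s ⟩
      (P n + -2ℚ * s) + 2ℚ * s           ≡⟨ cong (_+ 2ℚ * s) (⊛-oneMinus2xTimes P N n) ⟨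
      (P ⊛ oneMinus2xTimes N) n + 2ℚ * s ≡⟨ cong (_+ 2ℚ * s) (P⊛Q̂≋1 n) ⟩
      const 1ℚ n + 2ℚ * s                ∎
    halve : ∀ n → ½ * (const 1ℚ n + (const 1ℚ n + 2ℚ * s)) ≡ const 1ℚ n + s
    halve zero    = solve 1 (λ s → con ½ :* (con 1ℚ :+ (con 1ℚ :+ con 2ℚ :* s)) := con 1ℚ :+ s) refl s
    halve (suc n) = solve 1 (λ s → con ½ :* (con 0ℚ :+ (con 0ℚ :+ con 2ℚ :* s)) := con 0ℚ :+ s) refl s

  linear-recurrence-solution : ∀ N A C → A ≋ (C ⊕ (2ℚ · shift (A ⊛ N))) →
    (A ⊛ oneMinus2xTimes N) ≋ C
  linear-recurrence-solution N A C A≋C+2xAN n = begin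
    (A ⊛ oneMinus2xTimes N) n       ≡⟨ ⊛-oneMinus2xTimes A N n ⟩
    A n + -2ℚ * s                   ≡⟨ cong (_+ -2ℚ * s) (A≋C+2xAN n) ⟩
    (C n + 2ℚ * s) + -2ℚ * s        ≡⟨ solve 2 (λ c s → (c :+ con 2ℚ :* s) :+ con -2ℚ :* s := c) refl (C n) s ⟩
    C n                             ∎
    where
    open ≡-Reasoning
    s : ℚ
    s = shift (A ⊛ N) n

  ⊛-divide : ∀ {A C} Q P → (A ⊛ Q) ≋ C → (P ⊛ Q) ≋ const 1ℚ → A ≋ (C ⊛ P)
  ⊛-divide {A} {C} Q P A⊛Q≋C P⊛Q≋1 = begin
    A               ≈⟨ ⊛-identityʳ A ⟨
    A ⊛ const 1ℚ    ≈⟨ ⊛-congˡ A P⊛Q≋1 ⟨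
    A ⊛ (P ⊛ Q)     ≈⟨ ⊛-congˡ A (⊛-comm P Q) ⟩
    A ⊛ (Q ⊛ P)     ≈⟨ ⊛-assoc A Q P ⟨
    (A ⊛ Q) ⊛ P     ≈⟨ ⊛-congʳ P A⊛Q≋C ⟩
    C ⊛ P           ∎
    where open ≋-Reasoning

module OrderedForests where

  open import Data.Nat using (ℕ; zero; suc; _+_; _*_; _∸_; _<_; _≤_; _≡ᵇ_; _≟_; z≤n; s≤s)
  import Data.Nat.Properties as ℕ
  open import Data.Bool using (true; false; if_then_else_)
  open import Data.List using (List; []; _∷_; map; concat; concatMap; upTo; applyUpTo; length; filter; _++_)
  import Data.List.Properties as List
  open import Data.List.Relation.Unary.All using (All; []; _∷_)
  import Data.List.Relation.Unary.All as All
  import Data.List.Relation.Unary.All.Properties as All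
  open import Data.Nat.ListAction using (sum)
  open import Data.Nat.ListAction.Properties using (sum-++)
  open import Data.Nat.Tactic.RingSolver using (solve-∀)
  open import Function using (_∘_)
  open import Relation.Binary.PropositionalEquality

  sumOver : ∀ {A : Set} → List A → (A → ℕ) → ℕ
  sumOver xs w = sum (map w xs)

  sumOver-++ : ∀ {A : Set} (xs ys : List A) w → sumOver (xs ++ ys) w ≡ sumOver xs w + sumOver ys w
  sumOver-++ xs ys w = trans (cong sum (List.map-++ w xs ys)) (sum-++ (map w xs) (map w ys))

  sumOver-concatMap : ∀ {A B : Set} (h : A → List B) xs w →
    sumOver (concatMap h xs) w ≡ sumOver xs (λ x → sumOver (h x) w)
  sumOver-concatMap h []       w = refl
  sumOver-concatMap h (x ∷ xs) w =
    trans (sumOver-++ (h x) (concatMap h xs) w) (cong (sumOver (h x) w +_) (sumOver-concatMap h xs w))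

  sumOver-map : ∀ {A B : Set} (g : A → B) xs w → sumOver (map g xs) w ≡ sumOver xs (w ∘ g)
  sumOver-map g xs w = cong sum (sym (List.map-∘ xs))

  sumOver-cong : ∀ {A : Set} (xs : List A) {w w′} → (∀ x → w x ≡ w′ x) → sumOver xs w ≡ sumOver xs w′
  sumOver-cong xs w≗w′ = cong sum (List.map-cong w≗w′ xs)

  sumOver-congᴬ : ∀ {A : Set} {P : A → Set} {xs w w′} → All P xs → (∀ {x} → P x → w x ≡ w′ x) →
    sumOver xs w ≡ sumOver xs w′
  sumOver-congᴬ []         w≗w′ = refl
  sumOver-congᴬ (px ∷ pxs) w≗w′ = cong₂ _+_ (w≗w′ px) (sumOver-congᴬ pxs w≗w′)

  sumOver-+ : ∀ {A : Set} (xs : List A) f g → sumOver xs (λ x → f x + g x) ≡ sumOver xs f + sumOver xs g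
  sumOver-+ []       f g = refl
  sumOver-+ (x ∷ xs) f g = trans (cong (f x + g x +_) (sumOver-+ xs f g)) (interchange (f x) (g x) _ _)
    where
    interchange : ∀ a b c d → a + b + (c + d) ≡ a + c + (b + d)
    interchange = solve-∀

  sumOver-*ˡ : ∀ {A : Set} (xs : List A) c f → sumOver xs (λ x → c * f x) ≡ c * sumOver xs f
  sumOver-*ˡ []       c f = sym (ℕ.*-zeroʳ c)
  sumOver-*ˡ (x ∷ xs) c f = trans (cong (c * f x +_) (sumOver-*ˡ xs c f)) (sym (ℕ.*-distribˡ-+ c (f x) _))

  sumOver-const : ∀ {A : Set} (xs : List A) c → sumOver xs (λ _ → c) ≡ length xs * c
  sumOver-const []       c = refl
  sumOver-const (x ∷ xs) c = cong (c +_) (sumOver-const xs c)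

  sumOver-sumOver-+ : ∀ {A B : Set} (xs : List A) (ys : List B) f g →
    sumOver xs (λ x → sumOver ys (λ y → f x + g y)) ≡ length ys * sumOver xs f + length xs * sumOver ys g
  sumOver-sumOver-+ xs ys f g = begin
    sumOver xs (λ x → sumOver ys (λ y → f x + g y))
      ≡⟨ sumOver-cong xs (λ x → trans (sumOver-+ ys (λ _ → f x) g) (cong (_+ sumOver ys g) (sumOver-const ys (f x)))) ⟩
    sumOver xs (λ x → length ys * f x + sumOver ys g)
      ≡⟨ sumOver-+ xs (λ x → length ys * f x) (λ _ → sumOver ys g) ⟩
    sumOver xs (λ x → length ys * f x) + sumOver xs (λ _ → sumOver ys g)
      ≡⟨ cong₂ _+_ (sumOver-*ˡ xs (length ys) f) (sumOver-const xs (sumOver ys g)) ⟩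
    length ys * sumOver xs f + length xs * sumOver ys g
      ∎
    where open ≡-Reasoning

  length≡sumOver-1 : ∀ {A : Set} (xs : List A) → length xs ≡ sumOver xs (λ _ → 1)
  length≡sumOver-1 xs = trans (sym (ℕ.*-identityʳ (length xs))) (sym (sumOver-const xs 1))

  map-upTo-cong< : ∀ {A : Set} n {h h′ : ℕ → A} → (∀ i → i < n → h i ≡ h′ i) → map h (upTo n) ≡ map h′ (upTo n)
  map-upTo-cong< {A} n {h} {h′} h≗h′ = trans (List.map-upTo h n) (trans (applyUpTo-cong n h≗h′) (sym (List.map-upTo h′ n)))
    where
    applyUpTo-cong : ∀ n {h h′ : ℕ → A} → (∀ i → i < n → h i ≡ h′ i) → applyUpTo h n ≡ applyUpTo h′ n
    applyUpTo-cong zero    _    = refl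
    applyUpTo-cong (suc n) h≗h′ = cong₂ _∷_ (h≗h′ 0 (s≤s z≤n)) (applyUpTo-cong n (λ i i<n → h≗h′ (suc i) (s≤s i<n)))

  forestsF-fuel : ∀ {f g} m → m ≤ f → m ≤ g → forestsF f m ≡ forestsF g m
  forestsF-fuel zero _ _ = refl
  forestsF-fuel {suc f} {suc g} (suc m) (s≤s m≤f) (s≤s m≤g) = cong concat (map-upTo-cong< (suc m) sameParts)
    where
    sameParts : ∀ j → j < suc m →
      concatMap (λ cs → map (λ rest → node cs ∷ rest) (forestsF f (m ∸ j))) (forestsF f j) ≡
      concatMap (λ cs → map (λ rest → node cs ∷ rest) (forestsF g (m ∸ j))) (forestsF g j)
    sameParts j (s≤s j≤m) =
      cong₂ (λ X Y → concatMap (λ cs → map (λ rest → node cs ∷ rest) Y) X)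
        (forestsF-fuel j (ℕ.≤-trans j≤m m≤f) (ℕ.≤-trans j≤m m≤g))
        (forestsF-fuel (m ∸ j) (ℕ.≤-trans (ℕ.m∸n≤m m j) m≤f) (ℕ.≤-trans (ℕ.m∸n≤m m j) m≤g))

  forestsWithFirstTree : ℕ → ℕ → List (List Tree)
  forestsWithFirstTree m j = concatMap (λ cs → map (λ rest → node cs ∷ rest) (forests (m ∸ j))) (forests j)

  forests-suc : ∀ m → forests (suc m) ≡ concatMap (forestsWithFirstTree m) (upTo (suc m))
  forests-suc m = cong concat (map-upTo-cong< (suc m) enoughFuel)
    where
    enoughFuel : ∀ j → j < suc m → _ ≡ forestsWithFirstTree m j
    enoughFuel j (s≤s j≤m) =
      cong₂ (λ X Y → concatMap (λ cs → map (λ rest → node cs ∷ rest) Y) X)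
        (forestsF-fuel j j≤m ℕ.≤-refl)
        (forestsF-fuel (m ∸ j) (ℕ.m∸n≤m m j) ℕ.≤-refl)

  sumOver-forests-suc : ∀ m w → sumOver (forests (suc m)) w ≡
    sumOver (upTo (suc m)) (λ j → sumOver (forests j) (λ cs → sumOver (forests (m ∸ j)) (λ rest → w (node cs ∷ rest))))
  sumOver-forests-suc m w = begin
    sumOver (forests (suc m)) w
      ≡⟨ cong (λ F → sumOver F w) (forests-suc m) ⟩
    sumOver (concatMap (forestsWithFirstTree m) (upTo (suc m))) w
      ≡⟨ sumOver-concatMap (forestsWithFirstTree m) (upTo (suc m)) w ⟩
    sumOver (upTo (suc m)) (λ j → sumOver (forestsWithFirstTree m j) w)
      ≡⟨ sumOver-cong (upTo (suc m)) (λ j →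
           trans (sumOver-concatMap (λ cs → map (λ rest → node cs ∷ rest) (forests (m ∸ j))) (forests j) w)
                 (sumOver-cong (forests j) (λ cs → sumOver-map (λ rest → node cs ∷ rest) (forests (m ∸ j)) w))) ⟩
    sumOver (upTo (suc m)) (λ j → sumOver (forests j) (λ cs → sumOver (forests (m ∸ j)) (λ rest → w (node cs ∷ rest))))
      ∎
    where open ≡-Reasoning

  forestsF-size : ∀ f m → All (λ ts → sizeF ts ≡ m) (forestsF f m)
  forestsF-size f       zero    = refl ∷ []
  forestsF-size zero    (suc m) = []
  forestsF-size (suc f) (suc m) = All.concat⁺ (All.map⁺ (All.applyUpTo⁺₁ (λ j → j) (suc m) firstTreeSizes))
    where
    firstTreeSizes : ∀ {j} → j < suc m →
      All (λ ts → sizeF ts ≡ suc m) (concatMap (λ cs → map (λ rest → node cs ∷ rest) (forestsF f (m ∸ j))) (forestsF f j))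
    firstTreeSizes {j} (s≤s j≤m) = All.concat⁺ (All.map⁺ (All.map (λ cs-size → All.map⁺ (All.map
      (λ rest-size → cong suc (trans (cong₂ _+_ cs-size rest-size) (ℕ.m+[n∸m]≡n j≤m)))
      (forestsF-size f (m ∸ j)))) (forestsF-size f j)))

  forests-size : ∀ m → All (λ ts → sizeF ts ≡ m) (forests m)
  forests-size m = forestsF-size m m

  forestCount : ℕ → ℕ
  forestCount m = length (forests m)

  forestSubtreeCount : ℕ → ℕ → ℕ
  forestSubtreeCount k m = sumOver (forests m) (countSubF k)

  δ : ℕ → ℕ → ℕ
  δ k s = if s ≡ᵇ k then 1 else 0

  forestCount-suc : ∀ m → forestCount (suc m) ≡ sumOver (upTo (suc m)) (λ j → forestCount j * forestCount (m ∸ j))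
  forestCount-suc m = begin
    forestCount (suc m)
      ≡⟨ length≡sumOver-1 (forests (suc m)) ⟩
    sumOver (forests (suc m)) (λ _ → 1)
      ≡⟨ sumOver-forests-suc m (λ _ → 1) ⟩
    sumOver (upTo (suc m)) (λ j → sumOver (forests j) (λ _ → sumOver (forests (m ∸ j)) (λ _ → 1)))
      ≡⟨ sumOver-cong (upTo (suc m)) (λ j → trans
           (sumOver-cong (forests j) (λ _ → sym (length≡sumOver-1 (forests (m ∸ j)))))
           (sumOver-const (forests j) (forestCount (m ∸ j)))) ⟩
    sumOver (upTo (suc m)) (λ j → forestCount j * forestCount (m ∸ j))
      ∎
    where open ≡-Reasoning

  rootCount-suc : ∀ k m → rootCount k (suc m) ≡ forestCount m * δ k (suc m)
  rootCount-suc k m = count (forests m) (forests-size m)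
    where
    filter-∷ : ∀ t ts → length (filter (λ t → size t ≟ k) (t ∷ ts)) ≡
                        δ k (size t) + length (filter (λ t → size t ≟ k) ts)
    filter-∷ t ts with size t ≡ᵇ k
    ... | true  = refl
    ... | false = refl
    count : ∀ xs → All (λ ts → sizeF ts ≡ m) xs →
      length (filter (λ t → size t ≟ k) (map node xs)) ≡ length xs * δ k (suc m)
    count []        []                  = refl
    count (ts ∷ xs) (ts-size ∷ xs-size) =
      trans (filter-∷ (node ts) (map node xs)) (cong₂ _+_ (cong (δ k ∘ suc) ts-size) (count xs xs-size))

  ell-suc : ∀ k m → ell k (suc m) ≡ rootCount k (suc m) + forestSubtreeCount k m
  ell-suc k m = begin
    ell k (suc m)
      ≡⟨ sumOver-map node (forests m) (countSub k) ⟩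
    sumOver (forests m) (λ ts → δ k (suc (sizeF ts)) + countSubF k ts)
      ≡⟨ sumOver-+ (forests m) (λ ts → δ k (suc (sizeF ts))) (countSubF k) ⟩
    sumOver (forests m) (λ ts → δ k (suc (sizeF ts))) + forestSubtreeCount k m
      ≡⟨ cong (_+ forestSubtreeCount k m) (sumOver-congᴬ (forests-size m) (cong (δ k ∘ suc))) ⟩
    sumOver (forests m) (λ _ → δ k (suc m)) + forestSubtreeCount k m
      ≡⟨ cong (_+ forestSubtreeCount k m) (trans (sumOver-const (forests m) (δ k (suc m))) (sym (rootCount-suc k m))) ⟩
    rootCount k (suc m) + forestSubtreeCount k m
      ∎
    where open ≡-Reasoning

  forestSubtreeCount-suc : ∀ k m → forestSubtreeCount k (suc m) ≡
    sumOver (upTo (suc m)) (λ j → ell k (suc j) * forestCount (m ∸ j) + forestCount j * forestSubtreeCount k (m ∸ j))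
  forestSubtreeCount-suc k m = trans (sumOver-forests-suc m (countSubF k)) (sumOver-cong (upTo (suc m)) splitFirstTree)
    where
    splitFirstTree : ∀ j →
      sumOver (forests j) (λ ts → sumOver (forests (m ∸ j)) (λ rest → countSub k (node ts) + countSubF k rest)) ≡
      ell k (suc j) * forestCount (m ∸ j) + forestCount j * forestSubtreeCount k (m ∸ j)
    splitFirstTree j = trans (sumOver-sumOver-+ (forests j) (forests (m ∸ j)) (countSub k ∘ node) (countSubF k))
      (cong (_+ forestCount j * forestSubtreeCount k (m ∸ j))
        (trans (cong (forestCount (m ∸ j) *_) (sym (sumOver-map node (forests j) (countSub k))))
               (ℕ.*-comm (forestCount (m ∸ j)) (ell k (suc j)))))

module GeneratingFunctions where

  open FormalPowerSeries
  open OrderedForests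

  open import Data.Nat as ℕ using (zero; suc; _∸_)
  import Data.Integer as ℤ
  import Data.Integer.Properties as ℤ
  open import Data.List using (upTo; applyUpTo)
  import Data.List.Properties as List
  open import Data.Nat.ListAction using (sum)
  open import Data.Rational using (mkℚ; 0ℚ; _+_; _*_)
  import Data.Rational.Properties as ℚ
  import Data.Nat.Coprimality as Coprime
  open import Data.Rational.Solver using (module +-*-Solver)
  open import Function using (_∘_)
  open import Relation.Binary.PropositionalEquality using (refl; sym; trans; cong; cong₂; module ≡-Reasoning)

  open +-*-Solver

  fromℕ≡mkℚ : ∀ n → fromℕ n ≡ mkℚ (ℤ.+ n) 0 (Coprime.sym (Coprime.1-coprimeTo n))
  fromℕ≡mkℚ n = ℚ.normalize-coprime (Coprime.sym (Coprime.1-coprimeTo n))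

  fromℕ-+ : ∀ a b → fromℕ (a ℕ.+ b) ≡ fromℕ a + fromℕ b
  fromℕ-+ a b rewrite fromℕ≡mkℚ a | fromℕ≡mkℚ b =
    ℚ./-cong (trans (ℤ.pos-+ a b) (sym (cong₂ ℤ._+_ (ℤ.*-identityʳ (ℤ.+ a)) (ℤ.*-identityʳ (ℤ.+ b))))) refl

  fromℕ-* : ∀ a b → fromℕ (a ℕ.* b) ≡ fromℕ a * fromℕ b
  fromℕ-* a b rewrite fromℕ≡mkℚ a | fromℕ≡mkℚ b = ℚ./-cong (ℤ.pos-* a b) refl

  fromℕ-sumOver-upTo : ∀ n w → fromℕ (sumOver (upTo n) w) ≡ ∑ n (fromℕ ∘ w)
  fromℕ-sumOver-upTo n w = trans (cong (fromℕ ∘ sum) (List.map-upTo w n)) (fromℕ-sum-applyUpTo n w)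
    where
    fromℕ-sum-applyUpTo : ∀ n w → fromℕ (sum (applyUpTo w n)) ≡ ∑ n (fromℕ ∘ w)
    fromℕ-sum-applyUpTo zero    w = refl
    fromℕ-sum-applyUpTo (suc n) w =
      trans (fromℕ-+ (w 0) _) (cong (fromℕ (w 0) +_) (fromℕ-sum-applyUpTo n (w ∘ suc)))

  forestSeries : PS
  forestSeries = fromℕ ∘ forestCount

  forestSeries-equation : forestSeries ≋ (const 1ℚ ⊕ shift (forestSeries ⊛ forestSeries))
  forestSeries-equation zero    = refl
  forestSeries-equation (suc m) = begin
    fromℕ (forestCount (suc m))
      ≡⟨ cong fromℕ (forestCount-suc m) ⟩
    fromℕ (sumOver (upTo (suc m)) (λ j → forestCount j ℕ.* forestCount (m ∸ j)))
      ≡⟨ fromℕ-sumOver-upTo (suc m) (λ j → forestCount j ℕ.* forestCount (m ∸ j)) ⟩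
    ∑ (suc m) (λ j → fromℕ (forestCount j ℕ.* forestCount (m ∸ j)))
      ≡⟨ ∑-cong (suc m) (λ j → fromℕ-* (forestCount j) (forestCount (m ∸ j))) ⟩
    ∑ (suc m) (λ j → forestSeries j * forestSeries (m ∸ j))
      ≡⟨ ⊛-as-∑ forestSeries forestSeries m ⟨
    (forestSeries ⊛ forestSeries) m
      ≡⟨ ℚ.+-identityˡ _ ⟨
    0ℚ + (forestSeries ⊛ forestSeries) m
      ∎
    where open ≡-Reasoning

  module _ (k : ℕ) where

    subtreeSeries : PS
    subtreeSeries = fromℕ ∘ forestSubtreeCount k

    L-equation : L k ≋ (R k ⊕ shift subtreeSeries)
    L-equation zero    = refl
    L-equation (suc m) = trans (cong fromℕ (ell-suc k m)) (fromℕ-+ (rootCount k (suc m)) (forestSubtreeCount k m))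

    subtreeSeries-equation : subtreeSeries ≋ ((L k ⊛ forestSeries) ⊕ shift (forestSeries ⊛ subtreeSeries))
    subtreeSeries-equation zero    = refl
    subtreeSeries-equation (suc m) = begin
      fromℕ (forestSubtreeCount k (suc m))
        ≡⟨ cong fromℕ (forestSubtreeCount-suc k m) ⟩
      fromℕ (sumOver (upTo (suc m)) term)
        ≡⟨ fromℕ-sumOver-upTo (suc m) term ⟩
      ∑ (suc m) (fromℕ ∘ term)
        ≡⟨ ∑-cong (suc m) transferTerm ⟩
      ∑ (suc m) (λ j → L k (suc j) * forestSeries (m ∸ j) + forestSeries j * subtreeSeries (m ∸ j))
        ≡⟨ ∑-+ (suc m) (λ j → L k (suc j) * forestSeries (m ∸ j)) (λ j → forestSeries j * subtreeSeries (m ∸ j)) ⟩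
      ∑ (suc m) (λ j → L k (suc j) * forestSeries (m ∸ j)) + ∑ (suc m) (λ j → forestSeries j * subtreeSeries (m ∸ j))
        ≡⟨ cong₂ _+_ firstTrees (sym (⊛-as-∑ forestSeries subtreeSeries m)) ⟩
      (L k ⊛ forestSeries) (suc m) + (forestSeries ⊛ subtreeSeries) m
        ∎
      where
      open ≡-Reasoning
      term : ℕ → ℕ
      term j = ell k (suc j) ℕ.* forestCount (m ∸ j) ℕ.+ forestCount j ℕ.* forestSubtreeCount k (m ∸ j)
      transferTerm : ∀ j → fromℕ (term j) ≡ L k (suc j) * forestSeries (m ∸ j) + forestSeries j * subtreeSeries (m ∸ j)
      transferTerm j =
        trans (fromℕ-+ (ell k (suc j) ℕ.* forestCount (m ∸ j)) (forestCount j ℕ.* forestSubtreeCount k (m ∸ j)))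
              (cong₂ _+_ (fromℕ-* (ell k (suc j)) (forestCount (m ∸ j)))
                         (fromℕ-* (forestCount j) (forestSubtreeCount k (m ∸ j))))
      firstTrees : ∑ (suc m) (λ j → L k (suc j) * forestSeries (m ∸ j)) ≡ (L k ⊛ forestSeries) (suc m)
      firstTrees = sym (trans (⊛-as-∑ (L k) forestSeries (suc m))
        (trans (cong (_+ ∑ (suc m) (λ j → L k (suc j) * forestSeries (m ∸ j))) (ℚ.*-zeroˡ (forestSeries (suc m))))
               (ℚ.+-identityˡ _)))

    subtreeSeries-recurrence : subtreeSeries ≋ ((R k ⊛ forestSeries) ⊕ (2ℚ · shift (subtreeSeries ⊛ forestSeries)))
    subtreeSeries-recurrence = begin
      A                                      ≈⟨ subtreeSeries-equation ⟩
      (L k ⊛ N) ⊕ shift (N ⊛ A)              ≈⟨ ⊕-cong (⊛-congʳ N L-equation) (shift-cong (⊛-comm N A)) ⟩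
      ((R k ⊕ shift A) ⊛ N) ⊕ shift (A ⊛ N)  ≈⟨ ⊕-congʳ (shift (A ⊛ N)) (⊛-distribʳ N (R k) (shift A)) ⟩
      ((R k ⊛ N) ⊕ (shift A ⊛ N)) ⊕ shift (A ⊛ N) ≈⟨ ⊕-congʳ (shift (A ⊛ N)) (⊕-congˡ (R k ⊛ N) (shift-⊛ A N)) ⟩
      ((R k ⊛ N) ⊕ shift (A ⊛ N)) ⊕ shift (A ⊛ N) ≈⟨ doubling ⟩
      (R k ⊛ N) ⊕ (2ℚ · shift (A ⊛ N))       ∎
      where
      open ≋-Reasoning
      N A : PS
      N = forestSeries
      A = subtreeSeries
      doubling : (((R k ⊛ N) ⊕ shift (A ⊛ N)) ⊕ shift (A ⊛ N)) ≋ ((R k ⊛ N) ⊕ (2ℚ · shift (A ⊛ N)))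
      doubling n = solve 2 (λ r s → (r :+ s) :+ s := r :+ con 2ℚ :* s) refl ((R k ⊛ N) n) (shift (A ⊛ N) n)

open FormalPowerSeries
open GeneratingFunctions

mainTheorem4 : (k : ℕ) → 1 ≤ k →
    (Q P : PS) → Q 0 ≡ 1ℚ → (Q ⊛ Q) ≋ oneMinus4x → (P ⊛ Q) ≋ const 1ℚ →
    L k ≋ (R k ⊛ (½ · (const 1ℚ ⊕ P)))
mainTheorem4 k _ Q P Q₀≡1 Q²≋1-4x P⊛Q≋1 = begin
  L k                                   ≈⟨ L-equation k ⟩
  R k ⊕ shift (subtreeSeries k)         ≈⟨ ⊕-congˡ (R k) (shift-cong subtree≋RNP) ⟩
  R k ⊕ shift ((R k ⊛ N) ⊛ P)           ≈⟨ ⊕-congˡ (R k) (shift-cong (⊛-assoc (R k) N P)) ⟩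
  R k ⊕ shift (R k ⊛ (N ⊛ P))           ≈⟨ ⊛-1+shift (R k) (N ⊛ P) ⟨
  R k ⊛ (const 1ℚ ⊕ shift (N ⊛ P))      ≈⟨ ⊛-congˡ (R k) (half-one-plus-inverse N P P⊛Q̂≋1) ⟨
  R k ⊛ (½ · (const 1ℚ ⊕ P))            ∎
  where
  open ≋-Reasoning
  N Q̂ : PS
  N = forestSeries
  Q̂ = oneMinus2xTimes N
  Q≋Q̂ : Q ≋ Q̂
  Q≋Q̂ = square-root-unique Q Q̂ Q₀≡1 refl
          (λ n → trans (Q²≋1-4x n) (sym (oneMinus2xTimes-square N forestSeries-equation n)))
  P⊛Q̂≋1 : (P ⊛ Q̂) ≋ const 1ℚ
  P⊛Q̂≋1 n = trans (⊛-congˡ P (λ i → sym (Q≋Q̂ i)) n) (P⊛Q≋1 n)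
  subtree⊛Q≋RN : (subtreeSeries k ⊛ Q) ≋ (R k ⊛ N)
  subtree⊛Q≋RN n = trans (⊛-congˡ (subtreeSeries k) Q≋Q̂ n)
    (linear-recurrence-solution N (subtreeSeries k) (R k ⊛ N) (subtreeSeries-recurrence k) n)
  subtree≋RNP : subtreeSeries k ≋ ((R k ⊛ N) ⊛ P)
  subtree≋RNP = ⊛-divide Q P subtree⊛Q≋RN P⊛Q≋1
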